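{- Let $\mathcal{T}$ be the family of trees consisting of the path $P_4$ together with all trees obtainable from $P_4$ by a finite sequence of the operations $O_1,O_2,O_3,O_4$ described below, where each operation is applied to the current tree $T$: (O1) add a new vertex and join it to a vertex of $T$ that belongs to some $\gamma_{t,coi}(T)$-set; (O2) add a new path $P_2$ and join one of its vertices to a vertex of $T$ that belongs to some $\gamma_{t,coi}(T)$-set; (O3) add a new path $P_4=h_1u_1u_2h_2$ and join the leaf $h_1$ to a vertex $v$ of $T$ that belongs to some $\gamma_{t,coi}(T)$-set; (O4) add a new path $P_4=h_1u_1u_2h_2$ and join the support vertex $u_1$ to a vertex $v$ of $T$ that belongs to some maximum independent set of $T$. If $T\in\mathcal{T}$ has order $n$, then $\gamma_{t,coi}(T)=n-\beta(T)$.
   Context: All graphs are finite, simple and undirected. For a graph $G$, a set $D\subseteq V(G)$ is a total dominating set if every vertex of $G$ has at least one neighbor in $D$. A total dominating set $D$ is a total co-independent dominating set if $V(G)\setminus D$ is nonempty and independent. $\gamma_{t,coi}(G)$ is the minimum cardinality of a total co-independent dominating set of $G$, and a $\gamma_{t,coi}(G)$-set is a total co-independent dominating set of that cardinality. $\beta(G)$ is the maximum cardinality of an independent set of $G$. In a tree, a leaf is a vertex of degree one and a support vertex is a non-leaf vertex adjacent to a leaf. -}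

module Defs where

open import Data.Nat using (ℕ; zero; suc; _≤_)
open import Data.Fin using (Fin; zero; suc; _≟_)
open import Data.Fin.Subset using (Subset; _∈_; _∉_; ∣_∣)
open import Data.Bool using (Bool; true; false)
open import Data.Product using (Σ; ∃; _×_; _,_)
open import Relation.Nullary using (¬_)
open import Relation.Nullary.Decidable using (⌊_⌋)
open import Relation.Binary.PropositionalEquality using (_≡_)

Graph : ℕ → Set
Graph n = Fin n → Fin n → Bool

Adj : ∀ {n} → Graph n → Fin n → Fin n → Set
Adj G u v = G u v ≡ true

-- Add a new vertex (numbered zero; old vertices shifted by suc)
-- joined exactly to the old vertex v.
addLeaf : ∀ {n} → Graph n → Fin n → Graph (suc n)
addLeaf G v zero    zero    = false
addLeaf G v zero    (suc w) = ⌊ w ≟ v ⌋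
addLeaf G v (suc w) zero    = ⌊ w ≟ v ⌋
addLeaf G v (suc u) (suc w) = G u w

K1 : Graph 1
K1 _ _ = false

P4 : Graph 4
P4 = addLeaf (addLeaf (addLeaf K1 zero) zero) zero

IsTotalDominating : ∀ {n} → Graph n → Subset n → Set
IsTotalDominating G D = ∀ v → ∃ λ u → Adj G v u × u ∈ D

IsTCoID : ∀ {n} → Graph n → Subset n → Set
IsTCoID G D =
  IsTotalDominating G D ×
  (∃ λ v → v ∉ D) ×
  (∀ u v → u ∉ D → v ∉ D → ¬ Adj G u v)

IsGammaTCoISet : ∀ {n} → Graph n → Subset n → Set
IsGammaTCoISet G D = IsTCoID G D × (∀ D' → IsTCoID G D' → ∣ D ∣ ≤ ∣ D' ∣)

IsGammaTCoI : ∀ {n} → Graph n → ℕ → Set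
IsGammaTCoI G k = ∃ λ D → IsGammaTCoISet G D × ∣ D ∣ ≡ k

IsIndependent : ∀ {n} → Graph n → Subset n → Set
IsIndependent G I = ∀ u v → u ∈ I → v ∈ I → ¬ Adj G u v

IsMaxIndependent : ∀ {n} → Graph n → Subset n → Set
IsMaxIndependent G I = IsIndependent G I × (∀ J → IsIndependent G J → ∣ J ∣ ≤ ∣ I ∣)

IsBeta : ∀ {n} → Graph n → ℕ → Set
IsBeta G b = ∃ λ I → IsMaxIndependent G I × ∣ I ∣ ≡ b

data InT : ∀ {n} → Graph n → Set where
  base : InT P4
  O1 : ∀ {n} {T : Graph n} (v : Fin n) →
       InT T → (∃ λ D → IsGammaTCoISet T D × v ∈ D) →
       InT (addLeaf T v)
  O2 : ∀ {n} {T : Graph n} (v : Fin n) →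
       InT T → (∃ λ D → IsGammaTCoISet T D × v ∈ D) →
       InT (addLeaf (addLeaf T v) zero)
  O3 : ∀ {n} {T : Graph n} (v : Fin n) →
       InT T → (∃ λ D → IsGammaTCoISet T D × v ∈ D) →
       InT (addLeaf (addLeaf (addLeaf (addLeaf T v) zero) zero) zero)
  -- O4: new path h1 u1 u2 h2, u1 joined to v, v in some maximum independent set
  -- (u1 added first adjacent to v; then h1 adjacent to u1; then u2 adjacent
  --  to u1; then h2 adjacent to u2)
  O4 : ∀ {n} {T : Graph n} (v : Fin n) →
       InT T → (∃ λ I → IsMaxIndependent T I × v ∈ I) →
       InT (addLeaf (addLeaf (addLeaf (addLeaf T v) zero) (suc zero)) zero)

module Submission where

-- Call D a *certificate* for a graph G on n vertices if D is a
-- total co-independent dominating set and every independent set J satisfies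
-- |J| + |D| ≤ n.  Since the complement of any total co-independent dominating
-- set is independent, a certificate is a γ_{t,coi}(G)-set, and comparing it
-- with a maximum independent set I (|I| + |D| ≤ n) and with the independent set
-- ∁ D (|∁ D| ≤ |I|) gives |D| = n - β(G).
--
-- So it suffices to show that every tree of the family 𝒯 has a certificate.
-- P4 has one, and each operation O1–O4 turns a certificate of T into one of
-- the new tree.  The independence half of this rests on two facts about any
-- graph: deleting a vertex, or both ends of an edge, lowers β by at most one.
-- O1–O3 start from an arbitrary γ_{t,coi}(T)-set containing v; such a set is
-- itself a certificate as soon as T has some certificate, because it is no
-- larger.  O4 never needs its side condition on v: the support vertex u1 goes
-- into the new set, so every new vertex outside it has its neighbours inside.

open import Defs
open import Data.Nat using (ℕ; _∸_; suc; _+_; _≤_; z≤n; s≤s)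
open import Data.Nat.Properties
  using (≤-refl; ≤-trans; ≤-reflexive; ≤-antisym; n≤1+n; +-suc; +-monoˡ-≤; +-mono-≤;
         +-cancelˡ-≤; m∸n+n≡m; m+n∸m≡n)
open import Data.Fin using (Fin; zero; suc; _≟_)
open import Data.Fin.Subset using (Subset; _∈_; _∉_; ∣_∣; ∁)
open import Data.Fin.Subset.Properties using (x∈∁p⇒x∉p; ∣p∣≤n; ∣∁p∣≡n∸∣p∣)
open import Data.Vec.Base using (_∷_; []; here; there)
open import Data.Bool using (Bool; true; false)
open import Data.Bool.Properties using (T-≡)
open import Data.Product using (∃; _×_; _,_; proj₂)
open import Data.Sum using (_⊎_; inj₁; inj₂)
open import Data.Empty using (⊥; ⊥-elim)
open import Function.Bundles using (Equivalence)
open import Relation.Nullary using (¬_)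
open import Relation.Nullary.Decidable using (toWitness; isYes≗does; dec-true)
open import Relation.Binary.PropositionalEquality using (_≡_; refl; sym; trans; cong; subst)

complement-size : ∀ {n} (p : Subset n) → ∣ ∁ p ∣ + ∣ p ∣ ≡ n
complement-size p = trans (cong (_+ ∣ p ∣) (∣∁p∣≡n∸∣p∣ p)) (m∸n+n≡m (∣p∣≤n p))

size-cons : ∀ {n} (x : Bool) (p : Subset n) → ∣ x ∷ p ∣ ≤ suc ∣ p ∣
size-cons true  p = ≤-refl
size-cons false p = n≤1+n _

size-pair : ∀ {n} (x y : Bool) (p : Subset n) →
            (x ≡ true → y ≡ true → ⊥) → ∣ x ∷ y ∷ p ∣ ≤ suc ∣ p ∣
size-pair true  true  p both = ⊥-elim (both refl refl)
size-pair true  false p _ = ≤-refl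
size-pair false true  p _ = ≤-refl
size-pair false false p _ = n≤1+n _

member-head : ∀ {n} {x : Bool} {p : Subset n} → x ≡ true → zero ∈ x ∷ p
member-head refl = here

-- The graph obtained by deleting vertex zero; note  tail (addLeaf G v) = G.
tail : ∀ {n} → Graph (suc n) → Graph n
tail G u w = G (suc u) (suc w)

addPendantEdge : ∀ {n} → Graph n → Fin n → Graph (suc (suc n))
addPendantEdge G u = addLeaf (addLeaf G u) zero

addLeaf-adj : ∀ {n} {G : Graph n} (v : Fin n) → Adj (addLeaf G v) zero (suc v)
addLeaf-adj v = trans (isYes≗does (v ≟ v)) (dec-true (v ≟ v) refl)

addLeaf-adj⁻¹ : ∀ {n} {G : Graph n} {v w : Fin n} → Adj (addLeaf G v) zero (suc w) → w ≡ v
addLeaf-adj⁻¹ adj = toWitness (Equivalence.from T-≡ adj)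

SizeBound : ∀ {n} → Graph n → Subset n → Set
SizeBound {n} G D = ∀ J → IsIndependent G J → ∣ J ∣ + ∣ D ∣ ≤ n

independent-tail : ∀ {n} {G : Graph (suc n)} (x : Bool) (J : Subset n) →
                   IsIndependent G (x ∷ J) → IsIndependent (tail G) J
independent-tail x J ind u w u∈ w∈ = ind (suc u) (suc w) (there u∈) (there w∈)

-- β(G) ≤ β(G - z) + 1, phrased for a set D that the new vertex z avoids.
leaf-size-bound : ∀ {n} {G : Graph (suc n)} {D : Subset n} →
                  SizeBound (tail G) D → SizeBound G (false ∷ D)
leaf-size-bound {D = D} bound (x ∷ J) ind =
  ≤-trans (+-monoˡ-≤ ∣ D ∣ (size-cons x J)) (s≤s (bound J (independent-tail x J ind)))

-- β(G) ≤ β(G - z - z') + 1 for an edge zz', for a set D containing at most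
-- one of z, z'.
edge-size-bound : ∀ {n} {G : Graph (suc (suc n))} {D : Subset n} (a b : Bool) →
                  Adj G zero (suc zero) → (a ≡ true → b ≡ true → ⊥) →
                  SizeBound (tail (tail G)) D → SizeBound G (a ∷ b ∷ D)
edge-size-bound {G = G} {D} a b edge notBoth bound (x ∷ y ∷ J) ind =
  ≤-trans (+-mono-≤ (size-pair x y J endpointsNotBoth) (size-pair a b D notBoth))
          (s≤s (≤-trans (≤-reflexive (+-suc ∣ J ∣ ∣ D ∣)) (s≤s (bound J restricted))))
  where
  endpointsNotBoth : x ≡ true → y ≡ true → ⊥
  endpointsNotBoth x∈ y∈ = ind zero (suc zero) (member-head {p = y ∷ J} x∈) (there (member-head {p = J} y∈)) edge
  restricted : IsIndependent (tail (tail G)) J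
  restricted = independent-tail y J (independent-tail x (y ∷ J) ind)

DominatedAt : ∀ {n} → Graph n → Subset n → Fin n → Set
DominatedAt G D w = ∃ λ u → Adj G w u × u ∈ D

dominated-lift : ∀ {n} {G : Graph n} {D : Subset n} {v w : Fin n} (x : Bool) →
                 DominatedAt G D w → DominatedAt (addLeaf G v) (x ∷ D) (suc w)
dominated-lift x (u , adj , u∈) = suc u , adj , there u∈

leaf-dominated : ∀ {n} {G : Graph n} {D : Subset n} {v : Fin n} (x : Bool) →
                 v ∈ D → DominatedAt (addLeaf G v) (x ∷ D) zero
leaf-dominated {G = G} {v = v} x v∈ = suc v , addLeaf-adj {G = G} v , there v∈

CoIndependent : ∀ {n} → Graph n → Subset n → Set
CoIndependent G D = ∀ u v → u ∉ D → v ∉ D → ¬ Adj G u v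

coindependent-addLeaf : ∀ {n} {G : Graph n} {D : Subset n} (v : Fin n) (x : Bool) →
                        CoIndependent G D → x ≡ true ⊎ v ∈ D →
                        CoIndependent (addLeaf G v) (x ∷ D)
coindependent-addLeaf v x ci chosen zero zero _ _ ()
coindependent-addLeaf v x ci (inj₁ refl) zero (suc w) z∉ _ _ = z∉ here
coindependent-addLeaf {G = G} v x ci (inj₂ v∈) zero (suc w) _ w∉ adj
  with refl ← addLeaf-adj⁻¹ {G = G} adj = w∉ (there v∈)
coindependent-addLeaf v x ci (inj₁ refl) (suc u) zero _ z∉ _ = z∉ here
coindependent-addLeaf {G = G} v x ci (inj₂ v∈) (suc u) zero u∉ _ adj
  with refl ← addLeaf-adj⁻¹ {G = G} adj = u∉ (there v∈)
coindependent-addLeaf v x ci chosen (suc u) (suc w) u∉ w∉ adj =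
  ci u w (λ u∈ → u∉ (there u∈)) (λ w∈ → w∉ (there w∈)) adj

complement-independent : ∀ {n} {G : Graph n} {D : Subset n} →
                         CoIndependent G D → IsIndependent G (∁ D)
complement-independent ci u w u∈ w∈ = ci u w (x∈∁p⇒x∉p u∈) (x∈∁p⇒x∉p w∈)

Certificate : ∀ {n} → Graph n → Subset n → Set
Certificate G D = IsTCoID G D × SizeBound G D

-- A certificate is a γ_{t,coi}-set: any competitor D' has independent
-- complement, so |∁ D'| + |D| ≤ n = |∁ D'| + |D'|.
certificate-minimum : ∀ {n} {G : Graph n} {D : Subset n} →
                      Certificate G D → IsGammaTCoISet G D
certificate-minimum {D = D} (tcoid , bound) = tcoid , minimal
  where
  minimal : ∀ D' → IsTCoID _ D' → ∣ D ∣ ≤ ∣ D' ∣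
  minimal D' (_ , _ , ci') = +-cancelˡ-≤ ∣ ∁ D' ∣ _ _
    (subst (∣ ∁ D' ∣ + ∣ D ∣ ≤_) (sym (complement-size D'))
           (bound (∁ D') (complement-independent ci')))

-- Any γ_{t,coi}-set is no larger than a certificate, hence is one.
gamma-set-certificate : ∀ {n} {G : Graph n} {D₀ D : Subset n} →
                        Certificate G D₀ → IsGammaTCoISet G D → Certificate G D
gamma-set-certificate {D₀ = D₀} (tcoid₀ , bound₀) (tcoid , minimal) =
  tcoid , λ J ind → ≤-trans (+-mono-≤ ≤-refl (minimal D₀ tcoid₀)) (bound₀ J ind)

certificate-size : ∀ {n} {G : Graph n} {D : Subset n} {b : ℕ} →
                   Certificate G D → IsBeta G b → ∣ D ∣ ≡ n ∸ b
certificate-size {n} {D = D} {b} ((_ , _ , ci) , bound) (I , (indI , maxI) , refl) =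
  sym (trans (cong (_∸ b) (sym sum≡n)) (m+n∸m≡n b ∣ D ∣))
  where
  sum≡n : b + ∣ D ∣ ≡ n
  sum≡n = ≤-antisym (bound I indI)
    (subst (_≤ b + ∣ D ∣) (complement-size D)
      (+-monoˡ-≤ ∣ D ∣ (maxI (∁ D) (complement-independent ci))))

-- In the certificates below new vertices are numbered from zero (the last
-- added), and an old vertex w of T sits at w shifted past them.

-- P4 = a b c d with D = {b, c}; also the gadget h1 u1 u2 h2 of O3.
certificate-P4 : Certificate P4 (false ∷ true ∷ true ∷ false ∷ [])
certificate-P4 = (dom , (zero , λ ()) , ci) , bound
  where
  dom : IsTotalDominating P4 (false ∷ true ∷ true ∷ false ∷ [])
  dom zero                   = suc zero , refl , there here
  dom (suc zero)             = suc (suc zero) , refl , there (there here)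
  dom (suc (suc zero))       = suc zero , refl , there here
  dom (suc (suc (suc zero))) = suc (suc zero) , refl , there (there here)
  ci : CoIndependent P4 (false ∷ true ∷ true ∷ false ∷ [])
  ci = coindependent-addLeaf zero false
         (coindependent-addLeaf zero true
           (coindependent-addLeaf zero true (λ _ _ _ _ ()) (inj₁ refl)) (inj₁ refl))
         (inj₂ here)
  bound : SizeBound P4 (false ∷ true ∷ true ∷ false ∷ [])
  bound = edge-size-bound {G = P4} {D = true ∷ false ∷ []} false true refl (λ ())
            (edge-size-bound {G = tail (tail P4)} {D = []} true false refl (λ _ ())
              (λ { [] _ → z≤n }))

dominated-pendant-lift : ∀ {n} {G : Graph n} {D : Subset n} {u w : Fin n} (x y : Bool) →
                         DominatedAt G D w →
                         DominatedAt (addPendantEdge G u) (x ∷ y ∷ D) (suc (suc w))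
dominated-pendant-lift x y dom = dominated-lift x (dominated-lift y dom)

certificate-O1 : ∀ {n} {T : Graph n} {D : Subset n} (v : Fin n) →
                 Certificate T D → v ∈ D → Certificate (addLeaf T v) (false ∷ D)
certificate-O1 {T = T} {D} v ((dom , _ , ci) , bound) v∈ =
  (dom′ , (zero , λ ()) , coindependent-addLeaf v false ci (inj₂ v∈)) ,
  leaf-size-bound {G = addLeaf T v} {D = D} bound
  where
  dom′ : IsTotalDominating (addLeaf T v) (false ∷ D)
  dom′ zero    = leaf-dominated false v∈
  dom′ (suc w) = dominated-lift false (dom w)

-- O2 (path a b, a joined to v): a joins the set and is dominated by v.
certificate-O2 : ∀ {n} {T : Graph n} {D : Subset n} (v : Fin n) →
                 Certificate T D → v ∈ D →
                 Certificate (addPendantEdge T v) (false ∷ true ∷ D)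
certificate-O2 {T = T} {D} v ((dom , _ , ci) , bound) v∈ =
  (dom′ , (zero , λ ()) ,
   coindependent-addLeaf zero false (coindependent-addLeaf v true ci (inj₁ refl)) (inj₂ here)) ,
  edge-size-bound {G = addPendantEdge T v} {D = D} false true refl (λ ()) bound
  where
  dom′ : IsTotalDominating (addPendantEdge T v) (false ∷ true ∷ D)
  dom′ zero          = suc zero , refl , there here
  dom′ (suc zero)    = dominated-lift false (leaf-dominated true v∈)
  dom′ (suc (suc w)) = dominated-pendant-lift false true (dom w)

-- O3 (path h1 u1 u2 h2, h1 joined to v): u1, u2 join the set and dominate
-- the gadget; the edge h1 v is covered by v.
certificate-O3 : ∀ {n} {T : Graph n} {D : Subset n} (v : Fin n) →
                 Certificate T D → v ∈ D →
                 Certificate (addPendantEdge (addPendantEdge T v) zero)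
                             (false ∷ true ∷ true ∷ false ∷ D)
certificate-O3 {T = T} {D} v ((dom , _ , ci) , bound) v∈ =
  (dom′ , (zero , λ ()) , ci′) ,
  edge-size-bound {G = G} {D = true ∷ false ∷ D} false true refl (λ ())
    (edge-size-bound {G = addPendantEdge T v} {D = D} true false refl (λ _ ()) bound)
  where
  G : Graph (suc (suc (suc (suc _))))
  G = addPendantEdge (addPendantEdge T v) zero
  dom′ : IsTotalDominating G (false ∷ true ∷ true ∷ false ∷ D)
  dom′ zero                   = suc zero , refl , there here
  dom′ (suc zero)             = suc (suc zero) , refl , there (there here)
  dom′ (suc (suc zero))       = suc zero , refl , there here
  dom′ (suc (suc (suc zero))) = suc (suc zero) , refl , there (there here)
  dom′ (suc (suc (suc (suc w)))) =
    dominated-pendant-lift false true (dominated-pendant-lift true false (dom w))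
  ci′ : CoIndependent G (false ∷ true ∷ true ∷ false ∷ D)
  ci′ = coindependent-addLeaf zero false
          (coindependent-addLeaf zero true
            (coindependent-addLeaf zero true
              (coindependent-addLeaf v false ci (inj₂ v∈)) (inj₁ refl)) (inj₁ refl))
          (inj₂ here)

-- O4 (path h1 u1 u2 h2, u1 joined to v): the supports u1, u2 join the set;
-- every edge leaving a new vertex outside the set ends in u1 or u2.
certificate-O4 : ∀ {n} {T : Graph n} {D : Subset n} (v : Fin n) →
                 Certificate T D →
                 Certificate (addPendantEdge (addPendantEdge T v) (suc zero))
                             (false ∷ true ∷ false ∷ true ∷ D)
certificate-O4 {T = T} {D} v ((dom , _ , ci) , bound) =
  (dom′ , (zero , λ ()) , ci′) ,
  edge-size-bound {G = G} {D = false ∷ true ∷ D} false true refl (λ ())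
    (edge-size-bound {G = addPendantEdge T v} {D = D} false true refl (λ ()) bound)
  where
  G : Graph (suc (suc (suc (suc _))))
  G = addPendantEdge (addPendantEdge T v) (suc zero)
  dom′ : IsTotalDominating G (false ∷ true ∷ false ∷ true ∷ D)
  dom′ zero                   = suc zero , refl , there here
  dom′ (suc zero)             = suc (suc (suc zero)) , refl , there (there (there here))
  dom′ (suc (suc zero))       = suc (suc (suc zero)) , refl , there (there (there here))
  dom′ (suc (suc (suc zero))) = suc zero , refl , there here
  dom′ (suc (suc (suc (suc w)))) =
    dominated-pendant-lift false true (dominated-pendant-lift false true (dom w))
  ci′ : CoIndependent G (false ∷ true ∷ false ∷ true ∷ D)
  ci′ = coindependent-addLeaf zero false
          (coindependent-addLeaf (suc zero) true
            (coindependent-addLeaf zero false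
              (coindependent-addLeaf v true ci (inj₁ refl)) (inj₂ here)) (inj₁ refl))
          (inj₂ here)

-- Every tree of 𝒯 has a certificate.  For O1–O3 the chosen γ_{t,coi}(T)-set
-- containing v is a certificate because T already has one.
certify : ∀ {n} {T : Graph n} → InT T → ∃ (Certificate T)
certify base = _ , certificate-P4
certify (O1 v t (D , γ , v∈)) =
  _ , certificate-O1 v (gamma-set-certificate (proj₂ (certify t)) γ) v∈
certify (O2 v t (D , γ , v∈)) =
  _ , certificate-O2 v (gamma-set-certificate (proj₂ (certify t)) γ) v∈
certify (O3 v t (D , γ , v∈)) =
  _ , certificate-O3 v (gamma-set-certificate (proj₂ (certify t)) γ) v∈
certify (O4 v t _) = _ , certificate-O4 v (proj₂ (certify t))

lemma2 : ∀ {n} (T : Graph n) → InT T → ∀ b → IsBeta T b → IsGammaTCoI T (n ∸ b)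
lemma2 T t b β with certify t
... | D , certificate = D , certificate-minimum certificate , certificate-size certificate β
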